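{- Let $K=\mathbb{Q}(\sqrt{D})$ where $D\in\mathbb{Z}_{\ge2}$ is squarefree. If $\alpha=(\lceil\xi_D\rceil+2)+\omega_D$, then $p_K(\alpha)=4$.
   Context: Let $\omega_D=\sqrt{D}$ and $\xi_D=\sqrt D$ if $D\equiv2,3\pmod4$, and $\omega_D=\frac{1+\sqrt D}{2}$, $\xi_D=\frac{\sqrt D-1}{2}$ if $D\equiv1\pmod4$. $\mathcal{O}_K$ is the ring of integers of $K$ and $\mathcal{O}_K^+$ the set of totally positive elements of $\mathcal{O}_K$ (those $\gamma$ with $\gamma>0$, $\gamma'>0$, $'$ denoting Galois conjugation). A partition of $\alpha\in\mathcal{O}_K^+$ is an expression $\alpha=\alpha_1+\dots+\alpha_n$ with $n\ge1$ and $\alpha_i\in\mathcal{O}_K^+$, order irrelevant; $p_K(\alpha)$ is the number of partitions of $\alpha$. -}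

module Defs where

open import Data.Nat as ℕ using (ℕ; _%_)
open import Data.Nat.Divisibility using (_∣_)
open import Data.Integer as ℤ using (ℤ; +_; _+_; _*_; -_; _-_; _<_; _≤_)
open import Data.Product using (_×_; _,_; Σ; ∃)
open import Data.Sum using (_⊎_)
open import Data.Fin using (Fin)
open import Data.List using (List; []; foldr)
open import Data.List.Relation.Unary.All using (All)
open import Data.List.Relation.Binary.Permutation.Propositional using (_↭_)
open import Relation.Binary.PropositionalEquality using (_≡_; _≢_)
open import Relation.Nullary using (¬_)

Squarefree : ℕ → Set
Squarefree D = ∀ (n : ℕ) → (n ℕ.* n) ∣ D → n ≡ 1

-- The real number u + v·√D (u v : ℤ) is > 0.  (Exact case analysis.)
PosSqrt : ℕ → ℤ → ℤ → Set
PosSqrt D u v =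
    (ℤ.0ℤ ≤ u × ℤ.0ℤ ≤ v × ¬ (u ≡ ℤ.0ℤ × v ≡ ℤ.0ℤ))
  ⊎ (ℤ.0ℤ < u × v < ℤ.0ℤ × v * v * + D < u * u)
  ⊎ (u < ℤ.0ℤ × ℤ.0ℤ < v × u * u < v * v * + D)

NonNegSqrt : ℕ → ℤ → ℤ → Set
NonNegSqrt D u v = PosSqrt D u v ⊎ (u ≡ ℤ.0ℤ × v ≡ ℤ.0ℤ)

Is1mod4 : ℕ → Set
Is1mod4 D = D % 4 ≡ 1

-- Elements of O_K: the pair (a , b) stands for a + b·ω_D.
OK : Set
OK = ℤ × ℤ

_⊕_ : OK → OK → OK
(a , b) ⊕ (c , d) = (a + c , b + d)

sumOK : List OK → OK
sumOK = foldr _⊕_ (ℤ.0ℤ , ℤ.0ℤ)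

-- Twice the real embedding of a + bω_D, as (u , v) meaning u + v·√D:
--   D ≡ 1 (mod 4):  2(a + b(1+√D)/2) = (2a + b) + b√D
--   otherwise:      2(a + b√D)       = 2a + 2b√D
twiceEmb : ℕ → OK → ℤ × ℤ
twiceEmb D (a , b) with D % 4
... | 1 = (+ 2 * a + b , b)
... | _ = (+ 2 * a , + 2 * b)

twiceConj : ℕ → OK → ℤ × ℤ
twiceConj D x with twiceEmb D x
... | (u , v) = (u , - v)

Pos2 : ℕ → ℤ × ℤ → Set
Pos2 D (u , v) = PosSqrt D u v

TotallyPositive : ℕ → OK → Set
TotallyPositive D x = Pos2 D (twiceEmb D x) × Pos2 D (twiceConj D x)

-- Twice ξ_D as (u , v) meaning u + v√D:
--   D ≡ 1 (mod 4): 2ξ = -1 + √D ; otherwise 2ξ = 2√D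
twiceXi : ℕ → ℤ × ℤ
twiceXi D with D % 4
... | 1 = (ℤ.-1ℤ , ℤ.1ℤ)
... | _ = (ℤ.0ℤ , + 2)

-- c = ⌈ξ_D⌉ :  ξ_D ≤ c  and  c < ξ_D + 1
IsCeilXi : ℕ → ℤ → Set
IsCeilXi D c with twiceXi D
... | (u , v) = NonNegSqrt D (+ 2 * c - u) (- v) × PosSqrt D (u + + 2 - + 2 * c) v

-- A partition of α: a nonempty list of totally positive elements summing to α
-- (order is irrelevant: partitions are compared up to permutation, _↭_).
IsPartition : ℕ → OK → List OK → Set
IsPartition D α xs = xs ≢ [] × All (TotallyPositive D) xs × sumOK xs ≡ α

-- p_K(α) = n : there are exactly n partitions of α up to reordering.
PartitionCount : ℕ → OK → ℕ → Set
PartitionCount D α n =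
  Σ (Fin n → List OK) λ P →
      (∀ i → IsPartition D α (P i))
    × (∀ i j → P i ↭ P j → i ≡ j)
    × (∀ xs → IsPartition D α xs → ∃ λ i → xs ↭ P i)

-- With c = ⌈ξ_D⌉, the linear form ℓ(a + bω) = a − (c − 1)b is positive on totally positive
-- elements (in the coordinates of 2γ = u + v√D the relevant slope, c − 1 or 2c − 1, is below √D),
-- while ℓ(α) = 3. So a partition of α has at most three parts, each with ℓ ∈ {1, 2}. A part with
-- negative ω-coefficient has ℓ ≥ 2, with equality only for 2 − ω when D ≡ 1 (mod 4) and c = 1,
-- and then its cofactor 1 + 2ω is not totally positive. All other parts have ω-coefficient 0 or 1
-- and are determined by ℓ, leaving α = 1 + (c + 1 + ω) = 2 + (c + ω) = 1 + 1 + (c + ω).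
module Submission where

open import Data.Empty using (⊥; ⊥-elim)
open import Data.Fin using (Fin; zero; suc)
open import Data.Integer as ℤ
  using (ℤ; +_; +[1+_]; -[1+_]; _+_; _*_; -_; _-_; _<_; _≤_; 0ℤ; 1ℤ; -1ℤ; +≤+; +<+; -<+)
import Data.Integer.Properties as ℤP
open import Data.Integer.Tactic.RingSolver using (solve-∀)
open import Data.List using (List; []; _∷_; length)
open import Data.List.Membership.Propositional using (_∈_)
open import Data.List.Relation.Unary.All using (All; []; _∷_)
open import Data.List.Relation.Unary.Any using (here; there)
open import Data.List.Relation.Binary.Permutation.Propositional
  using (_↭_; ↭-refl; ↭-reflexive; ↭-sym; ↭-trans; ↭-prep; ↭-swap)
open import Data.List.Relation.Binary.Permutation.Propositional.Properties using (↭-length; ∈-resp-↭)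
open import Data.Nat as ℕ using (ℕ; suc; z≤n; s≤s; _%_)
import Data.Nat.Properties as ℕP
open import Data.Product using (_×_; _,_; proj₁; proj₂; ∃)
open import Data.Sum using (_⊎_; inj₁; inj₂)
open import Function.Bundles using (_⇔_; mk⇔; Equivalence)
open import Relation.Binary.Definitions using (tri<; tri≈; tri>)
open import Relation.Binary.PropositionalEquality
  using (_≡_; refl; sym; trans; cong; cong₂; subst; subst₂)
open import Relation.Nullary using (¬_; yes; no)

open import Defs

square-nonNeg : ∀ x → 0ℤ ≤ x * x
square-nonNeg (+ n)    = subst (0ℤ ≤_) (ℤP.pos-* n n) (+≤+ z≤n)
square-nonNeg -[1+ n ] = +≤+ z≤n

square-mono-≤ : ∀ {x y} → 0ℤ ≤ x → x ≤ y → x * x ≤ y * y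
square-mono-≤ {+ m} {+ n} _ (+≤+ m≤n) =
  subst₂ _≤_ (ℤP.pos-* m m) (ℤP.pos-* n n) (+≤+ (ℕP.*-mono-≤ m≤n m≤n))

square-cancel-< : ∀ {x y} → 0ℤ ≤ y → x * x < y * y → x < y
square-cancel-< {x} {y} 0≤y xx<yy with ℤP.<-cmp x y
... | tri< x<y _ _  = x<y
... | tri≈ _ refl _ = ⊥-elim (ℤP.<-irrefl refl xx<yy)
... | tri> _ _ y<x  = ⊥-elim (ℤP.<⇒≱ xx<yy (square-mono-≤ 0≤y (ℤP.<⇒≤ y<x)))

i<j⇒0<j-i : ∀ {i j} → i < j → 0ℤ < j - i
i<j⇒0<j-i {i} {j} i<j = subst (_< j - i) (ℤP.+-inverseʳ i) (ℤP.+-monoˡ-< (- i) i<j)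

0<half : ∀ {x y z} → y < x → x - y ≡ + 2 * z → 0ℤ < z
0<half y<x eq = ℤP.*-cancelˡ-<-nonNeg (+ 2) (subst (0ℤ <_) eq (i<j⇒0<j-i y<x))

positive-* : ∀ {x y} → 0ℤ < x → 0ℤ < y → 0ℤ < x * y
positive-* {+ 0}                  (+<+ ())
positive-* {+[1+ _ ]} {+ 0}       _ (+<+ ())
positive-* {+[1+ m ]} {+[1+ n ]} _ _ = +<+ (s≤s z≤n)

sum-of-positives : ∀ {x y} → 0ℤ < x → 0ℤ < y → + 2 < x + y ⊎ (x ≡ + 1 × y ≡ + 1)
sum-of-positives {+ 0}                        (+<+ ())
sum-of-positives {+[1+ _ ]}     {+ 0}          _ (+<+ ())
sum-of-positives {+[1+ 0 ]}     {+[1+ 0 ]}     _ _ = inj₂ (refl , refl)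
sum-of-positives {+[1+ 0 ]}     {+[1+ suc n ]} _ _ = inj₁ (+<+ (s≤s (s≤s (s≤s z≤n))))
sum-of-positives {+[1+ suc m ]} {+[1+ n ]}     _ _ =
  inj₁ (ℤP.+-mono-<-≤ (+<+ (s≤s (s≤s z≤n))) (+≤+ (s≤s z≤n)))

product≡1 : ∀ {x y} → 0ℤ < x → 0ℤ < y → x * y ≡ + 1 → x ≡ + 1 × y ≡ + 1
product≡1 {+ 0}                         (+<+ ())
product≡1 {+[1+ _ ]}     {+ 0}          _ (+<+ ())
product≡1 {+[1+ 0 ]}     {+[1+ 0 ]}     _ _ _ = refl , refl
product≡1 {+[1+ 0 ]}     {+[1+ suc _ ]} _ _ ()
product≡1 {+[1+ suc _ ]} {+[1+ 0 ]}     _ _ ()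
product≡1 {+[1+ suc _ ]} {+[1+ suc _ ]} _ _ ()

positive-pair-sum≡3 : ∀ {x y} → 0ℤ < x → 0ℤ < y → x + y ≡ + 3 →
                      (x ≡ + 1 × y ≡ + 2) ⊎ (x ≡ + 2 × y ≡ + 1)
positive-pair-sum≡3 {+ 0}                                      (+<+ ())
positive-pair-sum≡3 {+[1+ _ ]}           {+ 0}                _ (+<+ ())
positive-pair-sum≡3 {+[1+ 0 ]}           {+[1+ 1 ]}           _ _ _  = inj₁ (refl , refl)
positive-pair-sum≡3 {+[1+ 1 ]}           {+[1+ 0 ]}           _ _ _  = inj₂ (refl , refl)
positive-pair-sum≡3 {+[1+ 0 ]}           {+[1+ 0 ]}           _ _ ()
positive-pair-sum≡3 {+[1+ 0 ]}           {+[1+ suc (suc _) ]} _ _ ()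
positive-pair-sum≡3 {+[1+ 1 ]}           {+[1+ suc _ ]}       _ _ ()
positive-pair-sum≡3 {+[1+ suc (suc m) ]} {+[1+ n ]}           _ _ eq =
  ⊥-elim (ℕP.m+1+n≢0 m (ℕP.suc-injective (ℕP.suc-injective (ℕP.suc-injective (ℤP.+-injective eq)))))

positive-triple-sum≡3 : ∀ {x y z} → 0ℤ < x → 0ℤ < y → 0ℤ < z → x + (y + z) ≡ + 3 →
                        x ≡ + 1 × y ≡ + 1 × z ≡ + 1
positive-triple-sum≡3 0<x 0<y 0<z eq
  with positive-pair-sum≡3 0<x (ℤP.+-mono-< 0<y 0<z) eq | sum-of-positives 0<y 0<z
... | inj₁ (x≡1 , _)   | inj₂ (y≡1 , z≡1) = x≡1 , y≡1 , z≡1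
... | inj₁ (_ , y+z≡2) | inj₁ 2<y+z       = ⊥-elim (ℤP.<-irrefl (sym y+z≡2) 2<y+z)
... | inj₂ (_ , y+z≡1) | _                =
  ⊥-elim (ℤP.<-irrefl (sym y+z≡1) (ℤP.+-mono-≤-< (ℤP.i<j⇒suc[i]≤j 0<y) 0<z))

nonNeg-pair-sum≡1 : ∀ {x y} → 0ℤ ≤ x → 0ℤ ≤ y → x + y ≡ + 1 →
                    (x ≡ 0ℤ × y ≡ + 1) ⊎ (x ≡ + 1 × y ≡ 0ℤ)
nonNeg-pair-sum≡1 {+ 0}           {+ 1}           _ _ _ = inj₁ (refl , refl)
nonNeg-pair-sum≡1 {+ 1}           {+ 0}           _ _ _ = inj₂ (refl , refl)
nonNeg-pair-sum≡1 {+ 0}           {+ 0}           _ _ ()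
nonNeg-pair-sum≡1 {+ 0}           {+ suc (suc _)} _ _ ()
nonNeg-pair-sum≡1 {+ 1}           {+ suc _}       _ _ ()
nonNeg-pair-sum≡1 {+ suc (suc _)} {+ _}           _ _ ()

nonNeg-triple-sum≡1 : ∀ {x y z} → 0ℤ ≤ x → 0ℤ ≤ y → 0ℤ ≤ z → x + (y + z) ≡ + 1 →
    (x ≡ + 1 × y ≡ 0ℤ × z ≡ 0ℤ) ⊎ (x ≡ 0ℤ × y ≡ + 1 × z ≡ 0ℤ) ⊎ (x ≡ 0ℤ × y ≡ 0ℤ × z ≡ + 1)
nonNeg-triple-sum≡1 0≤x 0≤y 0≤z eq with nonNeg-pair-sum≡1 0≤x (ℤP.+-mono-≤ 0≤y 0≤z) eq
... | inj₂ (x≡1 , y+z≡0) = inj₁ (x≡1 , nonNeg-sum≡0 0≤y 0≤z y+z≡0)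
  where
  nonNeg-sum≡0 : ∀ {y z} → 0ℤ ≤ y → 0ℤ ≤ z → y + z ≡ 0ℤ → y ≡ 0ℤ × z ≡ 0ℤ
  nonNeg-sum≡0 {+ 0} {+ 0} _ _ _ = refl , refl
... | inj₁ (x≡0 , y+z≡1) with nonNeg-pair-sum≡1 0≤y 0≤z y+z≡1
...   | inj₁ (y≡0 , z≡1) = inj₂ (inj₂ (x≡0 , y≡0 , z≡1))
...   | inj₂ (y≡1 , z≡0) = inj₂ (inj₁ (x≡0 , y≡1 , z≡0))

-- Total positivity

-- u > |v|·√D, i.e. both u + v√D and u − v√D are positive.
record Dominant (D : ℕ) (u v : ℤ) : Set where
  constructor dominant
  field
    positive : 0ℤ < u
    bound    : v * v * + D < u * u

dominant-neg : ∀ {D u v} → Dominant D u v → Dominant D u (- v)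
dominant-neg {D} {u} {v} (dominant 0<u vvD<uu) =
  dominant 0<u (subst (λ t → t * + D < u * u) (sym (square-neg v)) vvD<uu)
  where
  square-neg : ∀ v → (- v) * (- v) ≡ v * v
  square-neg = solve-∀

dominant-neg⁻¹ : ∀ {D u v} → Dominant D u (- v) → Dominant D u v
dominant-neg⁻¹ {D} {u} {v} d = subst (Dominant D u) (ℤP.neg-involutive v) (dominant-neg d)

dominant-mono : ∀ {D u u′ v} → Dominant D u v → u ≤ u′ → Dominant D u′ v
dominant-mono (dominant 0<u vvD<uu) u≤u′ =
  dominant (ℤP.<-≤-trans 0<u u≤u′) (ℤP.<-≤-trans vvD<uu (square-mono-≤ (ℤP.<⇒≤ 0<u) u≤u′))

dominant-bound : ∀ {D u v} M → M * M ≤ + D → Dominant D u v → M * v < u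
dominant-bound {D} {u} {v} M MM≤D (dominant 0<u vvD<uu) = square-cancel-< (ℤP.<⇒≤ 0<u) (begin-strict
  (M * v) * (M * v) ≡⟨ regroup M v ⟩
  v * v * (M * M)   ≤⟨ ℤP.*-monoˡ-≤-nonNeg (v * v) {{ℤ.nonNegative (square-nonNeg v)}} MM≤D ⟩
  v * v * + D       <⟨ vvD<uu ⟩
  u * u             ∎)
  where
  open ℤP.≤-Reasoning
  regroup : ∀ M v → (M * v) * (M * v) ≡ v * v * (M * M)
  regroup = solve-∀

PosSqrt-neg⇒dominant : ∀ {D u v} → v < 0ℤ → PosSqrt D u v → Dominant D u v
PosSqrt-neg⇒dominant v<0 (inj₁ (_ , 0≤v , _))          = ⊥-elim (ℤP.<⇒≱ v<0 0≤v)
PosSqrt-neg⇒dominant v<0 (inj₂ (inj₁ (0<u , _ , ineq))) = dominant 0<u ineq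
PosSqrt-neg⇒dominant v<0 (inj₂ (inj₂ (_ , 0<v , _)))    = ⊥-elim (ℤP.<-asym v<0 0<v)

PosSqrt-zero⇒dominant : ∀ {D u} → PosSqrt D u 0ℤ → Dominant D u 0ℤ
PosSqrt-zero⇒dominant {u = +[1+ n ]} _                = dominant (+<+ (s≤s z≤n)) (+<+ (s≤s z≤n))
PosSqrt-zero⇒dominant {u = + 0} (inj₁ (_ , _ , u≢0))  = ⊥-elim (u≢0 (refl , refl))
PosSqrt-zero⇒dominant {u = -[1+ n ]} (inj₁ (() , _ , _))
PosSqrt-zero⇒dominant (inj₂ (inj₁ (_ , +<+ () , _)))
PosSqrt-zero⇒dominant (inj₂ (inj₂ (_ , +<+ () , _)))

PosSqrt-pos⇒ : ∀ {D u v} → 0ℤ < v → PosSqrt D u v → 0ℤ ≤ u ⊎ (u < 0ℤ × u * u < v * v * + D)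
PosSqrt-pos⇒ 0<v (inj₁ (0≤u , _ , _))           = inj₁ 0≤u
PosSqrt-pos⇒ 0<v (inj₂ (inj₁ (_ , v<0 , _)))    = ⊥-elim (ℤP.<-asym v<0 0<v)
PosSqrt-pos⇒ 0<v (inj₂ (inj₂ (u<0 , _ , ineq))) = inj₂ (u<0 , ineq)

PosSqrt-±⇒dominant : ∀ {D u v} → PosSqrt D u v → PosSqrt D u (- v) → Dominant D u v
PosSqrt-±⇒dominant {D} {u} {v} p q with ℤP.<-cmp v 0ℤ
... | tri< v<0 _ _  = PosSqrt-neg⇒dominant v<0 p
... | tri≈ _ refl _ = PosSqrt-zero⇒dominant p
... | tri> _ _ 0<v  = dominant-neg⁻¹ (PosSqrt-neg⇒dominant (ℤP.neg-mono-< 0<v) q)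

dominant⇒PosSqrt-± : ∀ {D u v} → Dominant D u v → PosSqrt D u v × PosSqrt D u (- v)
dominant⇒PosSqrt-± {D} {u} {+ 0} (dominant 0<u _) = zero-coefficient , zero-coefficient
  where
  zero-coefficient : PosSqrt D u 0ℤ
  zero-coefficient = inj₁ (ℤP.<⇒≤ 0<u , +≤+ z≤n , λ (u≡0 , _) → ℤP.<⇒≢ 0<u (sym u≡0))
dominant⇒PosSqrt-± {v = +[1+ n ]} (dominant 0<u ineq) =
  inj₁ (ℤP.<⇒≤ 0<u , +≤+ z≤n , λ ()) , inj₂ (inj₁ (0<u , -<+ , ineq))
dominant⇒PosSqrt-± {v = -[1+ n ]} (dominant 0<u ineq) =
  inj₂ (inj₁ (0<u , -<+ , ineq)) , inj₁ (ℤP.<⇒≤ 0<u , +≤+ z≤n , λ ())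

totallyPositive⇔dominant : ∀ D x →
  TotallyPositive D x ⇔ Dominant D (proj₁ (twiceEmb D x)) (proj₂ (twiceEmb D x))
totallyPositive⇔dominant D x with twiceEmb D x
... | (u , v) = mk⇔ (λ (p , q) → PosSqrt-±⇒dominant p q) dominant⇒PosSqrt-±

twiceEmb-1mod4 : ∀ {D} a b → Is1mod4 D → twiceEmb D (a , b) ≡ (+ 2 * a + b , b)
twiceEmb-1mod4 a b h rewrite h = refl

twiceEmb-not1mod4 : ∀ {D} a b → ¬ Is1mod4 D → twiceEmb D (a , b) ≡ (+ 2 * a , + 2 * b)
twiceEmb-not1mod4 {D} a b h with D % 4
... | 0           = refl
... | 1           = ⊥-elim (h refl)
... | suc (suc _) = refl

totallyPositive⇔-1mod4 : ∀ {D a b} → Is1mod4 D →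
  TotallyPositive D (a , b) ⇔ Dominant D (+ 2 * a + b) b
totallyPositive⇔-1mod4 {D} {a} {b} h =
  subst (λ e → TotallyPositive D (a , b) ⇔ Dominant D (proj₁ e) (proj₂ e))
        (twiceEmb-1mod4 {D} a b h) (totallyPositive⇔dominant D (a , b))

totallyPositive⇔-not1mod4 : ∀ {D a b} → ¬ Is1mod4 D →
  TotallyPositive D (a , b) ⇔ Dominant D (+ 2 * a) (+ 2 * b)
totallyPositive⇔-not1mod4 {D} {a} {b} h =
  subst (λ e → TotallyPositive D (a , b) ⇔ Dominant D (proj₁ e) (proj₂ e))
        (twiceEmb-not1mod4 {D} a b h) (totallyPositive⇔dominant D (a , b))

positive-integer-TP : ∀ D n → TotallyPositive D (+[1+ n ] , 0ℤ)
positive-integer-TP D n with D % 4 ℕ.≟ 1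
... | yes h = Equivalence.from (totallyPositive⇔-1mod4 {D} h) (dominant (+<+ (s≤s z≤n)) (+<+ (s≤s z≤n)))
... | no h  = Equivalence.from (totallyPositive⇔-not1mod4 {D} h) (dominant (+<+ (s≤s z≤n)) (+<+ (s≤s z≤n)))

isCeilXi-1mod4 : ∀ {D c} → Is1mod4 D → IsCeilXi D c →
  NonNegSqrt D (+ 2 * c - -1ℤ) (- 1ℤ) × PosSqrt D (-1ℤ + + 2 - + 2 * c) 1ℤ
isCeilXi-1mod4 h hc rewrite h = hc

isCeilXi-not1mod4 : ∀ {D c} → ¬ Is1mod4 D → IsCeilXi D c →
  NonNegSqrt D (+ 2 * c - 0ℤ) (- + 2) × PosSqrt D (0ℤ + + 2 - + 2 * c) (+ 2)
isCeilXi-not1mod4 {D} h hc with D % 4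
... | 0           = hc
... | 1           = ⊥-elim (h refl)
... | suc (suc _) = hc

-- With 2ξ = p + s√D the hypotheses say 2c − 2 < p + s√D ≤ 2c; the bound s²D ≥ 4 rules out c ≤ 1 + p/2.
ceiling-bounds : ∀ {D c p s} → 0ℤ < s → + 4 ≤ s * s * + D →
  NonNegSqrt D (+ 2 * c - p) (- s) → PosSqrt D (p + + 2 - + 2 * c) s →
  Dominant D (+ 2 * c - p) s × p + + 2 - + 2 * c < 0ℤ ×
  (p + + 2 - + 2 * c) * (p + + 2 - + 2 * c) < s * s * + D
ceiling-bounds 0<s _ (inj₂ (_ , -s≡0)) _ = ⊥-elim (ℤP.<⇒≢ (ℤP.neg-mono-< 0<s) -s≡0)
ceiling-bounds {D} {c} {p} {s} 0<s 4≤ssD (inj₁ upper) lower = from-lower (PosSqrt-pos⇒ 0<s lower)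
  where
  u w : ℤ
  u = + 2 * c - p
  w = p + + 2 - + 2 * c
  u-dominant : Dominant D u s
  u-dominant = dominant-neg⁻¹ (PosSqrt-neg⇒dominant (ℤP.neg-mono-< 0<s) upper)
  regroup : ∀ p c → p + + 2 - + 2 * c ≡ + 2 - (+ 2 * c - p)
  regroup = solve-∀
  from-lower : 0ℤ ≤ w ⊎ (w < 0ℤ × w * w < s * s * + D) →
               Dominant D u s × w < 0ℤ × w * w < s * s * + D
  from-lower (inj₂ (w<0 , ww<ssD)) = u-dominant , w<0 , ww<ssD
  from-lower (inj₁ 0≤w) = ⊥-elim (ℤP.<⇒≱ ssD<4 4≤ssD)
    where
    u≤2 : u ≤ + 2
    u≤2 = ℤP.0≤i-j⇒j≤i (subst (0ℤ ≤_) (regroup p c) 0≤w)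
    ssD<4 : s * s * + D < + 4
    ssD<4 = ℤP.<-≤-trans (Dominant.bound u-dominant)
                         (square-mono-≤ (ℤP.<⇒≤ (Dominant.positive u-dominant)) u≤2)

1mod4⇒4≤ : ∀ {D} → 2 ℕ.≤ D → Is1mod4 D → 4 ℕ.≤ D
1mod4⇒4≤ {suc (suc (suc (suc _)))} _ _ = s≤s (s≤s (s≤s (s≤s z≤n)))
1mod4⇒4≤ {1} (s≤s ()) _
1mod4⇒4≤ {2} _ ()
1mod4⇒4≤ {3} _ ()

ceiling-1mod4 : ∀ {D c} → 2 ℕ.≤ D → Is1mod4 D → IsCeilXi D c →
  Dominant D (+ 2 * c + 1ℤ) 1ℤ × 0ℤ < + 2 * c - 1ℤ × (+ 2 * c - 1ℤ) * (+ 2 * c - 1ℤ) ≤ + D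
ceiling-1mod4 {D} {c} 2≤D h hc =
  subst (λ u → Dominant D u 1ℤ) (u-identity c) (proj₁ bounds) ,
  subst (0ℤ <_) (w-identity c) (ℤP.neg-mono-< (proj₁ (proj₂ bounds))) ,
  ℤP.<⇒≤ (subst₂ _<_ (ww-identity c) (ℤP.*-identityˡ (+ D)) (proj₂ (proj₂ bounds)))
  where
  4≤D : + 4 ≤ 1ℤ * 1ℤ * + D
  4≤D = subst (+ 4 ≤_) (sym (ℤP.*-identityˡ (+ D))) (+≤+ (1mod4⇒4≤ 2≤D h))
  ceiling : NonNegSqrt D (+ 2 * c - -1ℤ) (- 1ℤ) × PosSqrt D (-1ℤ + + 2 - + 2 * c) 1ℤ
  ceiling = isCeilXi-1mod4 {D} {c} h hc
  bounds : Dominant D (+ 2 * c - -1ℤ) 1ℤ × -1ℤ + + 2 - + 2 * c < 0ℤ ×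
           (-1ℤ + + 2 - + 2 * c) * (-1ℤ + + 2 - + 2 * c) < 1ℤ * 1ℤ * + D
  bounds = ceiling-bounds {D} {c} { -1ℤ} {1ℤ} (+<+ (s≤s z≤n)) 4≤D (proj₁ ceiling) (proj₂ ceiling)
  u-identity : ∀ c → + 2 * c - -1ℤ ≡ + 2 * c + 1ℤ
  u-identity = solve-∀
  w-identity : ∀ c → - (-1ℤ + + 2 - + 2 * c) ≡ + 2 * c - 1ℤ
  w-identity = solve-∀
  ww-identity : ∀ c → (-1ℤ + + 2 - + 2 * c) * (-1ℤ + + 2 - + 2 * c) ≡ (+ 2 * c - 1ℤ) * (+ 2 * c - 1ℤ)
  ww-identity = solve-∀

ceiling-not1mod4 : ∀ {D c} → 2 ℕ.≤ D → ¬ Is1mod4 D → IsCeilXi D c →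
  Dominant D (+ 2 * c) (+ 2) × 0ℤ < c - 1ℤ × (c - 1ℤ) * (c - 1ℤ) ≤ + D
ceiling-not1mod4 {D} {c} 2≤D h hc =
  subst (λ u → Dominant D u (+ 2)) (ℤP.+-identityʳ (+ 2 * c)) (proj₁ bounds) ,
  ℤP.*-cancelˡ-<-nonNeg (+ 2) (subst (0ℤ <_) (w-identity c) (ℤP.neg-mono-< (proj₁ (proj₂ bounds)))) ,
  ℤP.<⇒≤ (ℤP.*-cancelˡ-<-nonNeg (+ 4) (subst (_< + 4 * + D) (ww-identity c) (proj₂ (proj₂ bounds))))
  where
  4≤4D : + 4 ≤ + 2 * + 2 * + D
  4≤4D = ℤP.*-monoˡ-≤-nonNeg (+ 4) (+≤+ (ℕP.<⇒≤ 2≤D))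
  ceiling : NonNegSqrt D (+ 2 * c - 0ℤ) (- + 2) × PosSqrt D (0ℤ + + 2 - + 2 * c) (+ 2)
  ceiling = isCeilXi-not1mod4 {D} {c} h hc
  bounds : Dominant D (+ 2 * c - 0ℤ) (+ 2) × 0ℤ + + 2 - + 2 * c < 0ℤ ×
           (0ℤ + + 2 - + 2 * c) * (0ℤ + + 2 - + 2 * c) < + 2 * + 2 * + D
  bounds = ceiling-bounds {D} {c} {0ℤ} {+ 2} (+<+ (s≤s z≤n)) 4≤4D (proj₁ ceiling) (proj₂ ceiling)
  w-identity : ∀ c → - (0ℤ + + 2 - + 2 * c) ≡ + 2 * (c - 1ℤ)
  w-identity = solve-∀
  ww-identity : ∀ c → (0ℤ + + 2 - + 2 * c) * (0ℤ + + 2 - + 2 * c) ≡ + 4 * ((c - 1ℤ) * (c - 1ℤ))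
  ww-identity = solve-∀

-- The linear form ℓ

form : ℤ → OK → ℤ
form c (a , b) = a - (c - 1ℤ) * b

form-⊕ : ∀ c x y → form c (x ⊕ y) ≡ form c x + form c y
form-⊕ c (a , b) (a′ , b′) = linear a b a′ b′ c
  where
  linear : ∀ a b a′ b′ c → a + a′ - (c - 1ℤ) * (b + b′) ≡ (a - (c - 1ℤ) * b) + (a′ - (c - 1ℤ) * b′)
  linear = solve-∀

form-zero : ∀ c → form c (0ℤ , 0ℤ) ≡ 0ℤ
form-zero = vanish
  where
  vanish : ∀ c → 0ℤ - (c - 1ℤ) * 0ℤ ≡ 0ℤ
  vanish = solve-∀

form-α : ∀ c → form c (c + + 2 , + 1) ≡ + 3
form-α = evaluate
  where
  evaluate : ∀ c → c + + 2 - (c - 1ℤ) * + 1 ≡ + 3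
  evaluate = solve-∀

form-inverse : ∀ c a b {l} → form c (a , b) ≡ l → a ≡ l + (c - 1ℤ) * b
form-inverse c a b eq = trans (recover a b c) (cong (_+ (c - 1ℤ) * b) eq)
  where
  recover : ∀ a b c → a ≡ a - (c - 1ℤ) * b + (c - 1ℤ) * b
  recover = solve-∀

unit-part : ∀ c a {l} → form c (a , 0ℤ) ≡ l → a ≡ l
unit-part c a {l} eq = trans (form-inverse c a 0ℤ eq) (vanish l c)
  where
  vanish : ∀ l c → l + (c - 1ℤ) * 0ℤ ≡ l
  vanish = solve-∀

ω-part₁ : ∀ c a → form c (a , + 1) ≡ + 1 → a ≡ c
ω-part₁ c a eq = trans (form-inverse c a (+ 1) eq) (simplify c)
  where
  simplify : ∀ c → + 1 + (c - 1ℤ) * + 1 ≡ c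
  simplify = solve-∀

ω-part₂ : ∀ c a → form c (a , + 1) ≡ + 2 → a ≡ c + + 1
ω-part₂ c a eq = trans (form-inverse c a (+ 1) eq) (simplify c)
  where
  simplify : ∀ c → + 2 + (c - 1ℤ) * + 1 ≡ c + + 1
  simplify = solve-∀

⊕-identityʳ : ∀ x → x ⊕ (0ℤ , 0ℤ) ≡ x
⊕-identityʳ (a , b) = cong₂ _,_ (ℤP.+-identityʳ a) (ℤP.+-identityʳ b)

record FormBounds (D : ℕ) (c : ℤ) : Set where
  field
    form-pos    : ∀ {x} → TotallyPositive D x → 0ℤ < form c x
    form-neg    : ∀ {a b} → TotallyPositive D (a , b) → b < 0ℤ →
                  + 2 < form c (a , b) ⊎ (form c (a , b) ≡ + 2 × b ≡ -1ℤ × c ≡ + 1)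
    1+2ω-not-TP : c ≡ + 1 → ¬ TotallyPositive D (+ 1 , + 2)
    ω-shift-TP  : ∀ {a} → c ≤ a → TotallyPositive D (a , + 1)

formBounds-1mod4 : ∀ {D c} → 2 ℕ.≤ D → Is1mod4 D → IsCeilXi D c → FormBounds D c
formBounds-1mod4 {D} {c} 2≤D h hc = record
  { form-pos    = λ {x} → form-pos x
  ; form-neg    = form-neg
  ; 1+2ω-not-TP = λ _ → 1+2ω-not-TP
  ; ω-shift-TP  = ω-shift-TP
  }
  where
  m : ℤ
  m = + 2 * c - 1ℤ
  ceiling : Dominant D (+ 2 * c + 1ℤ) 1ℤ × 0ℤ < m × m * m ≤ + D
  ceiling = ceiling-1mod4 2≤D h hc
  0<m : 0ℤ < m
  0<m = proj₁ (proj₂ ceiling)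
  mm≤D : m * m ≤ + D
  mm≤D = proj₂ (proj₂ ceiling)

  twice-dominant : ∀ {a b} → TotallyPositive D (a , b) → Dominant D (+ 2 * a + b) b
  twice-dominant = Equivalence.to (totallyPositive⇔-1mod4 {D} h)

  form-pos : ∀ x → TotallyPositive D x → 0ℤ < form c x
  form-pos (a , b) t = 0<half (dominant-bound m mm≤D (twice-dominant t)) (halve a b c)
    where
    halve : ∀ a b c → + 2 * a + b - (+ 2 * c - 1ℤ) * b ≡ + 2 * (a - (c - 1ℤ) * b)
    halve = solve-∀

  -- ℓ = (a + cb) + m·(−b), and a + cb > 0 is the other half of |m·b| < 2a + b.
  form-neg : ∀ {a b} → TotallyPositive D (a , b) → b < 0ℤ →
             + 2 < form c (a , b) ⊎ (form c (a , b) ≡ + 2 × b ≡ -1ℤ × c ≡ + 1)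
  form-neg {a} {b} t b<0 = split (sum-of-positives 0<a+cb (positive-* 0<m 0<-b))
    where
    0<-b : 0ℤ < - b
    0<-b = ℤP.neg-mono-< b<0
    halve : ∀ a b c → + 2 * a + b - (+ 2 * c - 1ℤ) * (- b) ≡ + 2 * (a + c * b)
    halve = solve-∀
    0<a+cb : 0ℤ < a + c * b
    0<a+cb = 0<half (dominant-bound m mm≤D (dominant-neg (twice-dominant t))) (halve a b c)
    decompose : ∀ a b c → a - (c - 1ℤ) * b ≡ (a + c * b) + (+ 2 * c - 1ℤ) * (- b)
    decompose = solve-∀
    m+1 : ∀ c → + 2 * c ≡ (+ 2 * c - 1ℤ) + 1ℤ
    m+1 = solve-∀
    split : + 2 < a + c * b + m * (- b) ⊎ (a + c * b ≡ + 1 × m * (- b) ≡ + 1) →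
            + 2 < form c (a , b) ⊎ (form c (a , b) ≡ + 2 × b ≡ -1ℤ × c ≡ + 1)
    split (inj₁ 2<sum) = inj₁ (subst (+ 2 <_) (sym (decompose a b c)) 2<sum)
    split (inj₂ (a+cb≡1 , m·-b≡1)) with product≡1 0<m 0<-b m·-b≡1
    ... | m≡1 , -b≡1 =
      inj₂ (trans (decompose a b c) (cong₂ _+_ a+cb≡1 m·-b≡1) ,
            ℤP.neg-injective -b≡1 ,
            ℤP.*-cancelˡ-≡ (+ 2) c (+ 1) (trans (m+1 c) (cong (_+ 1ℤ) m≡1)))

  1+2ω-not-TP : ¬ TotallyPositive D (+ 1 , + 2)
  1+2ω-not-TP t = ℤP.<⇒≱ (Dominant.bound (twice-dominant t))
                         (ℤP.*-monoˡ-≤-nonNeg (+ 4) (+≤+ (1mod4⇒4≤ 2≤D h)))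

  ω-shift-TP : ∀ {a} → c ≤ a → TotallyPositive D (a , + 1)
  ω-shift-TP c≤a = Equivalence.from (totallyPositive⇔-1mod4 {D} h)
    (dominant-mono (proj₁ ceiling) (ℤP.+-monoˡ-≤ 1ℤ (ℤP.*-monoˡ-≤-nonNeg (+ 2) c≤a)))

formBounds-not1mod4 : ∀ {D c} → 2 ℕ.≤ D → ¬ Is1mod4 D → IsCeilXi D c → FormBounds D c
formBounds-not1mod4 {D} {c} 2≤D h hc = record
  { form-pos    = λ {x} → form-pos x
  ; form-neg    = λ t b<0 → inj₁ (2<form t b<0)
  ; 1+2ω-not-TP = λ c≡1 _ → ℤP.<-irrefl refl (subst (λ c′ → 0ℤ < c′ - 1ℤ) c≡1 0<M)
  ; ω-shift-TP  = ω-shift-TP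
  }
  where
  M : ℤ
  M = c - 1ℤ
  ceiling : Dominant D (+ 2 * c) (+ 2) × 0ℤ < M × M * M ≤ + D
  ceiling = ceiling-not1mod4 2≤D h hc
  0<M : 0ℤ < M
  0<M = proj₁ (proj₂ ceiling)
  MM≤D : M * M ≤ + D
  MM≤D = proj₂ (proj₂ ceiling)

  twice-dominant : ∀ {a b} → TotallyPositive D (a , b) → Dominant D (+ 2 * a) (+ 2 * b)
  twice-dominant = Equivalence.to (totallyPositive⇔-not1mod4 {D} h)

  form-pos : ∀ x → TotallyPositive D x → 0ℤ < form c x
  form-pos (a , b) t = 0<half (dominant-bound M MM≤D (twice-dominant t)) (halve a b c)
    where
    halve : ∀ a b c → + 2 * a - (c - 1ℤ) * (+ 2 * b) ≡ + 2 * (a - (c - 1ℤ) * b)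
    halve = solve-∀

  -- ℓ = (a + Mb) + 2M·(−b) with a + Mb > 0 and M·(−b) ≥ 1.
  2<form : ∀ {a b} → TotallyPositive D (a , b) → b < 0ℤ → + 2 < form c (a , b)
  2<form {a} {b} t b<0 = subst (+ 2 <_) (sym (decompose a b c))
    (ℤP.+-mono-<-≤ 0<a+Mb (ℤP.*-monoˡ-≤-nonNeg (+ 2) (ℤP.i<j⇒suc[i]≤j (positive-* 0<M (ℤP.neg-mono-< b<0)))))
    where
    halve : ∀ a b c → + 2 * a - (c - 1ℤ) * (- (+ 2 * b)) ≡ + 2 * (a + (c - 1ℤ) * b)
    halve = solve-∀
    0<a+Mb : 0ℤ < a + M * b
    0<a+Mb = 0<half (dominant-bound M MM≤D (dominant-neg (twice-dominant t))) (halve a b c)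
    decompose : ∀ a b c → a - (c - 1ℤ) * b ≡ (a + (c - 1ℤ) * b) + + 2 * ((c - 1ℤ) * (- b))
    decompose = solve-∀

  ω-shift-TP : ∀ {a} → c ≤ a → TotallyPositive D (a , + 1)
  ω-shift-TP c≤a = Equivalence.from (totallyPositive⇔-not1mod4 {D} h)
    (dominant-mono (proj₁ ceiling) (ℤP.*-monoˡ-≤-nonNeg (+ 2) c≤a))

-- Partitions of α

module Partitions {D : ℕ} {c : ℤ} (bounds : FormBounds D c) where

  open FormBounds bounds

  α : OK
  α = (c + + 2 , + 1)

  candidate : Fin 4 → List OK
  candidate zero                   = α ∷ []
  candidate (suc zero)             = (+ 1 , 0ℤ) ∷ (c + + 1 , + 1) ∷ []
  candidate (suc (suc zero))       = (+ 2 , 0ℤ) ∷ (c , + 1) ∷ []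
  candidate (suc (suc (suc zero))) = (+ 1 , 0ℤ) ∷ (+ 1 , 0ℤ) ∷ (c , + 1) ∷ []

  candidate-partition : ∀ i → IsPartition D α (candidate i)
  candidate-partition zero =
    (λ ()) , ω-shift-TP (ℤP.i≤i+j c (+ 2)) ∷ [] , ⊕-identityʳ α
  candidate-partition (suc zero) =
    (λ ()) , positive-integer-TP D 0 ∷ ω-shift-TP (ℤP.i≤i+j c (+ 1)) ∷ [] ,
    cong₂ _,_ (total c) refl
    where
    total : ∀ c → + 1 + (c + + 1 + 0ℤ) ≡ c + + 2
    total = solve-∀
  candidate-partition (suc (suc zero)) =
    (λ ()) , positive-integer-TP D 1 ∷ ω-shift-TP ℤP.≤-refl ∷ [] ,
    cong₂ _,_ (total c) refl
    where
    total : ∀ c → + 2 + (c + 0ℤ) ≡ c + + 2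
    total = solve-∀
  candidate-partition (suc (suc (suc zero))) =
    (λ ()) , positive-integer-TP D 0 ∷ positive-integer-TP D 0 ∷ ω-shift-TP ℤP.≤-refl ∷ [] ,
    cong₂ _,_ (total c) refl
    where
    total : ∀ c → + 1 + (+ 1 + (c + 0ℤ)) ≡ c + + 2
    total = solve-∀

  1∉candidate₂ : ¬ (+ 1 , 0ℤ) ∈ candidate (suc (suc zero))
  1∉candidate₂ (here ())
  1∉candidate₂ (there (here ()))
  1∉candidate₂ (there (there ()))

  candidate-injective : ∀ i j → candidate i ↭ candidate j → i ≡ j
  candidate-injective zero                   zero                   _ = refl
  candidate-injective (suc zero)             (suc zero)             _ = refl
  candidate-injective (suc (suc zero))       (suc (suc zero))       _ = refl
  candidate-injective (suc (suc (suc zero))) (suc (suc (suc zero))) _ = refl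
  candidate-injective (suc zero) (suc (suc zero)) p = ⊥-elim (1∉candidate₂ (∈-resp-↭ p (here refl)))
  candidate-injective (suc (suc zero)) (suc zero) p = ⊥-elim (1∉candidate₂ (∈-resp-↭ (↭-sym p) (here refl)))
  candidate-injective zero                   (suc zero)             p with () ← ↭-length p
  candidate-injective zero                   (suc (suc zero))       p with () ← ↭-length p
  candidate-injective zero                   (suc (suc (suc zero))) p with () ← ↭-length p
  candidate-injective (suc zero)             zero                   p with () ← ↭-length p
  candidate-injective (suc zero)             (suc (suc (suc zero))) p with () ← ↭-length p
  candidate-injective (suc (suc zero))       zero                   p with () ← ↭-length p
  candidate-injective (suc (suc zero))       (suc (suc (suc zero))) p with () ← ↭-length p
  candidate-injective (suc (suc (suc zero))) zero                   p with () ← ↭-length p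
  candidate-injective (suc (suc (suc zero))) (suc zero)             p with () ← ↭-length p
  candidate-injective (suc (suc (suc zero))) (suc (suc zero))       p with () ← ↭-length p

  form-of-α : ∀ {z} → z ≡ α → form c z ≡ + 3
  form-of-α refl = form-α c

  length≤form : ∀ {xs} → All (TotallyPositive D) xs → + length xs ≤ form c (sumOK xs)
  length≤form {[]} [] = subst (+ 0 ≤_) (sym (form-zero c)) ℤP.≤-refl
  length≤form {x ∷ xs} (t ∷ ts) = subst (+ length (x ∷ xs) ≤_) (sym (form-⊕ c x (sumOK xs)))
    (ℤP.+-mono-≤ (ℤP.i<j⇒suc[i]≤j (form-pos t)) (length≤form ts))

  1<form : ∀ {a b} → TotallyPositive D (a , b) → b < 0ℤ → + 1 < form c (a , b)
  1<form t b<0 with form-neg t b<0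
  ... | inj₁ 2<f         = ℤP.<-trans (+<+ (s≤s (s≤s z≤n))) 2<f
  ... | inj₂ (f≡2 , _)   = subst (+ 1 <_) (sym f≡2) (+<+ (s≤s (s≤s z≤n)))

  form≡1⇒nonNeg : ∀ {a b} → TotallyPositive D (a , b) → form c (a , b) ≡ + 1 → 0ℤ ≤ b
  form≡1⇒nonNeg t f≡1 = ℤP.≮⇒≥ (λ b<0 → ℤP.<-irrefl (sym f≡1) (1<form t b<0))

  -- A negative ω-coefficient forces the part 2 − ω with c = 1, whose cofactor is 1 + 2ω.
  no-negative-part : ∀ {a₁ b₁ a₂ b₂} → TotallyPositive D (a₁ , b₁) → TotallyPositive D (a₂ , b₂) →
                     form c (a₁ , b₁) + form c (a₂ , b₂) ≡ + 3 → b₁ + b₂ ≡ + 1 → 0ℤ ≤ b₁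
  no-negative-part {a₁} {b₁} {a₂} {b₂} t₁ t₂ f≡3 b≡1 = ℤP.≮⇒≥ λ b₁<0 →
    refute (form-neg t₁ b₁<0) (positive-pair-sum≡3 (form-pos t₁) (form-pos t₂) f≡3)
    where
    f₁ = form c (a₁ , b₁)
    f₂ = form c (a₂ , b₂)
    cofactor : b₁ ≡ -1ℤ → c ≡ + 1 → f₂ ≡ + 1 → (a₂ , b₂) ≡ (+ 1 , + 2)
    cofactor b₁≡-1 c≡1 f₂≡1 = cong₂ _,_
      (trans (form-inverse c a₂ b₂ f₂≡1) (cong (λ c′ → + 1 + (c′ - 1ℤ) * b₂) c≡1))
      (trans (isolate b₁ b₂) (cong₂ _-_ b≡1 b₁≡-1))
      where
      isolate : ∀ b₁ b₂ → b₂ ≡ (b₁ + b₂) - b₁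
      isolate = solve-∀
    refute : + 2 < f₁ ⊎ (f₁ ≡ + 2 × b₁ ≡ -1ℤ × c ≡ + 1) →
             (f₁ ≡ + 1 × f₂ ≡ + 2) ⊎ (f₁ ≡ + 2 × f₂ ≡ + 1) → ⊥
    refute (inj₁ 2<f₁)     (inj₁ (f₁≡1 , _)) = ℤP.<-asym 2<f₁ (subst (_< + 2) (sym f₁≡1) (+<+ (s≤s (s≤s z≤n))))
    refute (inj₁ 2<f₁)     (inj₂ (f₁≡2 , _)) = ℤP.<-irrefl (sym f₁≡2) 2<f₁
    refute (inj₂ (f₁≡2 , _)) (inj₁ (f₁≡1 , _)) with () ← trans (sym f₁≡1) f₁≡2
    refute (inj₂ (_ , b₁≡-1 , c≡1)) (inj₂ (_ , f₂≡1)) =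
      1+2ω-not-TP c≡1 (subst (TotallyPositive D) (cofactor b₁≡-1 c≡1 f₂≡1) t₂)

  two-parts : ∀ {a₁ b₁ a₂ b₂} → TotallyPositive D (a₁ , b₁) → TotallyPositive D (a₂ , b₂) →
              form c (a₁ , b₁) + form c (a₂ , b₂) ≡ + 3 → b₁ + b₂ ≡ + 1 →
              ∃ λ i → (a₁ , b₁) ∷ (a₂ , b₂) ∷ [] ↭ candidate i
  two-parts {a₁} {b₁} {a₂} {b₂} t₁ t₂ f≡3 b≡1
    with nonNeg-pair-sum≡1 (no-negative-part t₁ t₂ f≡3 b≡1)
                           (no-negative-part t₂ t₁ (trans (ℤP.+-comm (form c (a₂ , b₂)) (form c (a₁ , b₁))) f≡3) (trans (ℤP.+-comm b₂ b₁) b≡1)) b≡1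
       | positive-pair-sum≡3 (form-pos t₁) (form-pos t₂) f≡3
  ... | inj₁ (refl , refl) | inj₁ (f₁≡1 , f₂≡2)
    rewrite unit-part c a₁ f₁≡1 | ω-part₂ c a₂ f₂≡2 = suc zero , ↭-refl
  ... | inj₁ (refl , refl) | inj₂ (f₁≡2 , f₂≡1)
    rewrite unit-part c a₁ f₁≡2 | ω-part₁ c a₂ f₂≡1 = suc (suc zero) , ↭-refl
  ... | inj₂ (refl , refl) | inj₁ (f₁≡1 , f₂≡2)
    rewrite ω-part₁ c a₁ f₁≡1 | unit-part c a₂ f₂≡2 = suc (suc zero) , ↭-swap _ _ ↭-refl
  ... | inj₂ (refl , refl) | inj₂ (f₁≡2 , f₂≡1)
    rewrite ω-part₂ c a₁ f₁≡2 | unit-part c a₂ f₂≡1 = suc zero , ↭-swap _ _ ↭-refl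

  three-parts : ∀ {a₁ b₁ a₂ b₂ a₃ b₃} →
    TotallyPositive D (a₁ , b₁) → TotallyPositive D (a₂ , b₂) → TotallyPositive D (a₃ , b₃) →
    form c (a₁ , b₁) + (form c (a₂ , b₂) + form c (a₃ , b₃)) ≡ + 3 → b₁ + (b₂ + b₃) ≡ + 1 →
    ∃ λ i → (a₁ , b₁) ∷ (a₂ , b₂) ∷ (a₃ , b₃) ∷ [] ↭ candidate i
  three-parts {a₁} {b₁} {a₂} {b₂} {a₃} {b₃} t₁ t₂ t₃ f≡3 b≡1
    with positive-triple-sum≡3 (form-pos t₁) (form-pos t₂) (form-pos t₃) f≡3
  ... | f₁≡1 , f₂≡1 , f₃≡1
    with nonNeg-triple-sum≡1 (form≡1⇒nonNeg t₁ f₁≡1) (form≡1⇒nonNeg t₂ f₂≡1) (form≡1⇒nonNeg t₃ f₃≡1) b≡1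
  ... | inj₁ (refl , refl , refl)
    rewrite ω-part₁ c a₁ f₁≡1 | unit-part c a₂ f₂≡1 | unit-part c a₃ f₃≡1 =
      suc (suc (suc zero)) , ↭-trans (↭-swap _ _ ↭-refl) (↭-prep _ (↭-swap _ _ ↭-refl))
  ... | inj₂ (inj₁ (refl , refl , refl))
    rewrite unit-part c a₁ f₁≡1 | ω-part₁ c a₂ f₂≡1 | unit-part c a₃ f₃≡1 =
      suc (suc (suc zero)) , ↭-prep _ (↭-swap _ _ ↭-refl)
  ... | inj₂ (inj₂ (refl , refl , refl))
    rewrite unit-part c a₁ f₁≡1 | unit-part c a₂ f₂≡1 | ω-part₁ c a₃ f₃≡1 =
      suc (suc (suc zero)) , ↭-refl

  partition-complete : ∀ xs → IsPartition D α xs → ∃ λ i → xs ↭ candidate i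
  partition-complete [] (xs≢[] , _) = ⊥-elim (xs≢[] refl)
  partition-complete (x ∷ []) (_ , _ , sum≡α) =
    zero , ↭-reflexive (cong (_∷ []) (trans (sym (⊕-identityʳ x)) sum≡α))
  partition-complete (x@(_ , _) ∷ y@(_ , _) ∷ []) (_ , t₁ ∷ t₂ ∷ [] , sum≡α) =
    two-parts t₁ t₂ (trans (sym (form-⊕ c x y)) (form-of-α x⊕y≡α)) (cong proj₂ x⊕y≡α)
    where
    x⊕y≡α : x ⊕ y ≡ α
    x⊕y≡α = trans (cong (x ⊕_) (sym (⊕-identityʳ y))) sum≡α
  partition-complete (x@(_ , _) ∷ y@(_ , _) ∷ z@(_ , _) ∷ []) (_ , t₁ ∷ t₂ ∷ t₃ ∷ [] , sum≡α) =
    three-parts t₁ t₂ t₃ forms (cong proj₂ x⊕y⊕z≡α)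
    where
    x⊕y⊕z≡α : x ⊕ (y ⊕ z) ≡ α
    x⊕y⊕z≡α = trans (cong (λ w → x ⊕ (y ⊕ w)) (sym (⊕-identityʳ z))) sum≡α
    forms : form c x + (form c y + form c z) ≡ + 3
    forms = trans (sym (trans (form-⊕ c x (y ⊕ z)) (cong (λ f → form c x + f) (form-⊕ c y z))))
                  (form-of-α x⊕y⊕z≡α)
  partition-complete xs@(_ ∷ _ ∷ _ ∷ _ ∷ _) (_ , ts , sum≡α) =
    ⊥-elim (ℤP.<⇒≱ (+<+ (s≤s (s≤s (s≤s (s≤s z≤n))))) (subst (+ length xs ≤_) (form-of-α sum≡α) (length≤form ts)))

partitions-of-α : ∀ {D c} → FormBounds D c → PartitionCount D (c + + 2 , + 1) 4
partitions-of-α bounds = candidate , candidate-partition , candidate-injective , partition-complete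
  where
  open Partitions bounds

theorem6p1 : (D : ℕ) → 2 ℕ.≤ D → Squarefree D →
    (c : ℤ) → IsCeilXi D c →
    PartitionCount D ((c + + 2) , + 1) 4
theorem6p1 D 2≤D _ c hc with D % 4 ℕ.≟ 1
... | yes h = partitions-of-α (formBounds-1mod4 2≤D h hc)
... | no h  = partitions-of-α (formBounds-not1mod4 2≤D h hc)
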